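{- If $\Gamma\vdash M:\phi$ in $\lambda Z$ and $M\to N$, then $\Gamma\vdash N:\phi$ (Subject Reduction).
   Context: IZF${}_R$ syntax: intuitionistic first-order logic without equality; binary relation $\in$; terms are variables, $\emptyset$, $\omega$, $\{t,u\}$, $\bigcup t$, $P(t)$, $S_{\phi(a,\vec f)}(t,\vec u)$, $R_{\phi(a,b,\vec f)}(t,\vec u)$; formulas from $t\in u$, $\bot$ via $\land,\lor,\to,\forall,\exists$; $t=u$ means $\forall z.\ z\in t\leftrightarrow z\in u$, $0:=\emptyset$, $S(t):=\bigcup\{t,\{t,t\}\}$. Class axioms $\forall\vec a\,\forall c.\ c\in t_A(\vec a)\leftrightarrow\phi_A(c,\vec a)$: (EMPTY) $\emptyset$, $\bot$; (PAIR) $\{a,b\}$, $c=a\lor c=b$; (INF) $\omega$, $c=0\lor\exists b\in\omega.\ c=S(b)$; (SEP${}_\phi$) $S_{\phi(a,\vec f)}(a,\vec f)$, $c\in a\land\phi(c,\vec f)$; (UNION) $\bigcup a$, $\exists b\in a.\ c\in b$; (POWER) $P(a)$, $\forall b.\ b\in c\to b\in a$; (REPL${}_\phi$) $R_{\phi(a,b,\vec f)}(a,\vec f)$, $(\forall x\in a\,\exists!y.\ \phi(x,y,\vec f))\land\exists x\in a.\ \phi(x,c,\vec f)$; names ax $\in\{$empty, pair, inf, sep${}_\phi$, union, power, repl${}_\phi\}$. $\lambda Z$ terms: $M::=x\mid M\,N\mid\lambda a.M\mid\lambda x:\phi.M\mid\mathrm{inl}(M)\mid\mathrm{inr}(M)\mid\mathrm{fst}(M)\mid\mathrm{snd}(M)\mid[t,M]\mid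 M\,t\mid\langle M,N\rangle\mid\mathrm{case}(M,x:\phi.N,x:\psi.O)\mid\mathrm{magic}(M)\mid\mathrm{let}\ [a,x:\phi]:=M\ \mathrm{in}\ N\mid\mathrm{axRep}(t,\vec u,M)\mid\mathrm{axProp}(t,\vec u,M)\mid\mathrm{ind}_{\phi(a,\vec b)}(\vec t,M)$ (modulo $\alpha$). Base reductions: $(\lambda x:\phi.M)N\to M[x:=N]$; $(\lambda a.M)t\to M[a:=t]$; $\mathrm{fst}\langle M,N\rangle\to M$; $\mathrm{snd}\langle M,N\rangle\to N$; $\mathrm{case}(\mathrm{inl}(M),x:\phi.N,x:\psi.O)\to N[x:=M]$; $\mathrm{case}(\mathrm{inr}(M),x:\phi.N,x:\psi.O)\to O[x:=M]$; $\mathrm{let}\ [a,x:\phi]:=[t,M]\ \mathrm{in}\ N\to N[a:=t][x:=M]$; $\mathrm{axProp}(t,\vec u,\mathrm{axRep}(t,\vec u,M))\to M$; $\mathrm{ind}_{\phi(a,\vec b)}(\vec t,M)\to\lambda c.\ M\,c\,(\lambda b.\lambda x:b\in c.\ \mathrm{ind}_{\phi(a,\vec b)}(\vec t,M)\,b)$ ($c,b,x$ fresh). $\to$ is the closure of base rules under evaluation contexts $[\circ]::=\mathrm{fst}([\circ])\mid\mathrm{snd}([\circ])\mid\mathrm{case}([\circ],x:\phi.M,x:\psi.N)\mid\mathrm{axProp}(t,\vec u,[\circ])\mid\mathrm{let}\ [a,y:\phi]:=[\circ]\ \mathrm{in}\ N\mid[\circ]\,M\mid\mathrm{magic}([\circ])$.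 Typing ($\Gamma$ finite set of declarations $x:\phi$): $\Gamma,x:\phi\vdash x:\phi$; from $\Gamma,x:\phi\vdash M:\psi$ infer $\Gamma\vdash\lambda x:\phi.M:\phi\to\psi$; from $M:\phi\to\psi$, $N:\phi$ infer $M\,N:\psi$; $\langle M,N\rangle:\phi\land\psi$ from $M:\phi,N:\psi$; $\mathrm{fst}(M):\phi$, $\mathrm{snd}(M):\psi$ from $M:\phi\land\psi$; $\mathrm{inl}(M):\phi\lor\psi$ from $M:\phi$; $\mathrm{inr}(M):\phi\lor\psi$ from $M:\psi$; $\Gamma\vdash\mathrm{case}(M,x:\phi.N,x:\psi.O):\vartheta$ from $\Gamma\vdash M:\phi\lor\psi$, $\Gamma,x:\phi\vdash N:\vartheta$, $\Gamma,x:\psi\vdash O:\vartheta$; $\Gamma\vdash\lambda a.M:\forall a.\phi$ from $\Gamma\vdash M:\phi$ if $a$ not free in $\Gamma$; $M\,t:\phi[a:=t]$ from $M:\forall a.\phi$; $[t,M]:\exists a.\phi$ from $M:\phi[a:=t]$; $\Gamma\vdash\mathrm{let}\ [a,x:\phi]:=M\ \mathrm{in}\ N:\psi$ from $\Gamma\vdash M:\exists a.\phi$, $\Gamma,x:\phi\vdash N:\psi$ if $a$ not free in $\Gamma,\psi$; $\mathrm{magic}(M):\phi$ from $M:\bot$; $\mathrm{axRep}(t,\vec u,M):t\in t_A(\vec u)$ from $M:\phi_A(t,\vec u)$; $\mathrm{axProp}(t,\vec u,M):\phi_A(t,\vec u)$ from $M:t\in t_A(\vec u)$; $\mathrm{ind}_{\phi(a,\vec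 f)}(\vec t,M):\forall a.\phi(a,\vec t)$ from $M:\forall c.(\forall b.\ b\in c\to\phi(b,\vec t))\to\phi(c,\vec t)$. -}

module Defs where

-- Alpha-equivalence is built in (de Bruijn indices).

open import Data.Nat using (ℕ; zero; suc)
open import Data.Fin using (Fin; zero; suc)
open import Data.Vec using (Vec; []; _∷_; lookup)
import Data.Vec as V

private
  variable
    n n' m m' k : ℕ

infix  6 _∈ₛ_
infixr 5 _∧ₛ_
infixr 4 _∨ₛ_
infixr 3 _⇒ₛ_

mutual
  -- IZF_R terms.  sepT φ t us is S_{φ(a,f⃗)}(t,u⃗): φ is a template whose free
  -- variables are exactly a (index 0) and f⃗ (indices 1..k).
  -- replT φ t us is R_{φ(a,b,f⃗)}(t,u⃗): a = 0, b = 1, f⃗ = 2..k+1.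
  data Term : ℕ → Set where
    var   : Fin n → Term n
    ∅ₛ    : Term n
    ωₛ    : Term n
    upair : Term n → Term n → Term n
    ⋃ₛ    : Term n → Term n
    Pₛ    : Term n → Term n
    sepT  : Formula (suc k) → Term n → Vec (Term n) k → Term n
    replT : Formula (suc (suc k)) → Term n → Vec (Term n) k → Term n

  data Formula : ℕ → Set where
    _∈ₛ_ : Term n → Term n → Formula n
    ⊥ₛ   : Formula n
    _∧ₛ_ : Formula n → Formula n → Formula n
    _∨ₛ_ : Formula n → Formula n → Formula n
    _⇒ₛ_ : Formula n → Formula n → Formula n
    ∀ₛ   : Formula (suc n) → Formula n
    ∃ₛ   : Formula (suc n) → Formula n

liftR : (Fin n → Fin m) → Fin (suc n) → Fin (suc m)
liftR ρ zero    = zero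
liftR ρ (suc i) = suc (ρ i)

mutual
  renT : (Fin n → Fin m) → Term n → Term m
  renT ρ (var i)         = var (ρ i)
  renT ρ ∅ₛ              = ∅ₛ
  renT ρ ωₛ              = ωₛ
  renT ρ (upair t u)     = upair (renT ρ t) (renT ρ u)
  renT ρ (⋃ₛ t)          = ⋃ₛ (renT ρ t)
  renT ρ (Pₛ t)          = Pₛ (renT ρ t)
  renT ρ (sepT φ t us)   = sepT φ (renT ρ t) (renTs ρ us)
  renT ρ (replT φ t us)  = replT φ (renT ρ t) (renTs ρ us)

  renTs : (Fin n → Fin m) → Vec (Term n) k → Vec (Term m) k
  renTs ρ []       = []
  renTs ρ (t ∷ ts) = renT ρ t ∷ renTs ρ ts

renF : (Fin n → Fin m) → Formula n → Formula m
renF ρ (t ∈ₛ u)  = renT ρ t ∈ₛ renT ρ u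
renF ρ ⊥ₛ        = ⊥ₛ
renF ρ (φ ∧ₛ ψ)  = renF ρ φ ∧ₛ renF ρ ψ
renF ρ (φ ∨ₛ ψ)  = renF ρ φ ∨ₛ renF ρ ψ
renF ρ (φ ⇒ₛ ψ)  = renF ρ φ ⇒ₛ renF ρ ψ
renF ρ (∀ₛ φ)    = ∀ₛ (renF (liftR ρ) φ)
renF ρ (∃ₛ φ)    = ∃ₛ (renF (liftR ρ) φ)

wkT : Term n → Term (suc n)
wkT = renT suc

wkTs : Vec (Term n) k → Vec (Term (suc n)) k
wkTs = renTs suc

wkF : Formula n → Formula (suc n)
wkF = renF suc

liftS : (Fin n → Term m) → Fin (suc n) → Term (suc m)
liftS σ zero    = var zero
liftS σ (suc i) = wkT (σ i)

mutual
  subT : (Fin n → Term m) → Term n → Term m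
  subT σ (var i)         = σ i
  subT σ ∅ₛ              = ∅ₛ
  subT σ ωₛ              = ωₛ
  subT σ (upair t u)     = upair (subT σ t) (subT σ u)
  subT σ (⋃ₛ t)          = ⋃ₛ (subT σ t)
  subT σ (Pₛ t)          = Pₛ (subT σ t)
  subT σ (sepT φ t us)   = sepT φ (subT σ t) (subTs σ us)
  subT σ (replT φ t us)  = replT φ (subT σ t) (subTs σ us)

  subTs : (Fin n → Term m) → Vec (Term n) k → Vec (Term m) k
  subTs σ []       = []
  subTs σ (t ∷ ts) = subT σ t ∷ subTs σ ts

subF : (Fin n → Term m) → Formula n → Formula m
subF σ (t ∈ₛ u)  = subT σ t ∈ₛ subT σ u
subF σ ⊥ₛ        = ⊥ₛ
subF σ (φ ∧ₛ ψ)  = subF σ φ ∧ₛ subF σ ψ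
subF σ (φ ∨ₛ ψ)  = subF σ φ ∨ₛ subF σ ψ
subF σ (φ ⇒ₛ ψ)  = subF σ φ ⇒ₛ subF σ ψ
subF σ (∀ₛ φ)    = ∀ₛ (subF (liftS σ) φ)
subF σ (∃ₛ φ)    = ∃ₛ (subF (liftS σ) φ)

single : Term n → Fin (suc n) → Term n
single t zero    = t
single t (suc i) = var i

_[_]F : Formula (suc n) → Term n → Formula n
φ [ t ]F = subF (single t) φ

inst : Formula (suc k) → Term n → Vec (Term n) k → Formula n
inst φ t us = subF (lookup (t ∷ us)) φ

_⇔ₛ_ : Formula n → Formula n → Formula n
φ ⇔ₛ ψ = (φ ⇒ₛ ψ) ∧ₛ (ψ ⇒ₛ φ)

_≐_ : Term n → Term n → Formula n
t ≐ u = ∀ₛ ((var zero ∈ₛ wkT t) ⇔ₛ (var zero ∈ₛ wkT u))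

zeroₛ : Term n
zeroₛ = ∅ₛ

Sₛ : Term n → Term n
Sₛ t = ⋃ₛ (upair t (upair t t))

∃!ₛ : Formula (suc n) → Formula n
∃!ₛ ψ = ∃ₛ (ψ ∧ₛ ∀ₛ (renF (liftR suc) ψ ⇒ₛ (var zero ≐ var (suc zero))))

-- Axioms: names, the class term t_A, and the defining formula φ_A(c, a⃗)
-- (template with c = index 0, a⃗ = indices 1..k).

data Ax : ℕ → Set where
  empty  : Ax 0
  pair   : Ax 2
  inf    : Ax 0
  sep    : Formula (suc k) → Ax (suc k)
  union  : Ax 1
  power  : Ax 1
  repl   : Formula (suc (suc k)) → Ax (suc k)

tA : Ax k → Vec (Term n) k → Term n
tA empty    []            = ∅ₛ
tA pair     (a ∷ b ∷ [])  = upair a b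
tA inf      []            = ωₛ
tA (sep φ)  (a ∷ fs)      = sepT φ a fs
tA union    (a ∷ [])      = ⋃ₛ a
tA power    (a ∷ [])      = Pₛ a
tA (repl φ) (a ∷ fs)      = replT φ a fs

private
  v0 : Term (suc n)
  v0 = var zero
  v1 : Term (suc (suc n))
  v1 = var (suc zero)
  v2 : Term (suc (suc (suc n)))
  v2 = var (suc (suc zero))

  -- for sep: φ(a,f⃗) ↦ φ(c,f⃗) in scope (c, a, f⃗)
  σsep : Fin (suc k) → Term (suc (suc k))
  σsep zero    = var zero
  σsep (suc i) = var (suc (suc i))

  -- for repl, first conjunct: scope (y, x, c, a, f⃗); φ(x,y,f⃗)
  σrepl₁ : Fin (suc (suc k)) → Term (suc (suc (suc (suc k))))
  σrepl₁ zero          = var (suc zero)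
  σrepl₁ (suc zero)    = var zero
  σrepl₁ (suc (suc i)) = var (suc (suc (suc (suc i))))

  -- for repl, second conjunct: scope (x, c, a, f⃗); φ(x,c,f⃗)
  σrepl₂ : Fin (suc (suc k)) → Term (suc (suc (suc k)))
  σrepl₂ zero          = var zero
  σrepl₂ (suc zero)    = var (suc zero)
  σrepl₂ (suc (suc i)) = var (suc (suc (suc i)))

φA : Ax k → Formula (suc k)
φA empty    = ⊥ₛ
-- (PAIR) c = a ∨ c = b        scope (c, a, b)
φA pair     = (v0 ≐ v1) ∨ₛ (v0 ≐ v2)
-- (INF) c = 0 ∨ ∃b ∈ ω. c = S(b)     scope (c); under ∃: (b, c)
φA inf      = (v0 ≐ zeroₛ) ∨ₛ ∃ₛ ((v0 ∈ₛ ωₛ) ∧ₛ (v1 ≐ Sₛ v0))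
-- (SEP_φ) c ∈ a ∧ φ(c, f⃗)      scope (c, a, f⃗)
φA (sep φ)  = (v0 ∈ₛ v1) ∧ₛ subF σsep φ
-- (UNION) ∃b ∈ a. c ∈ b        scope (c, a); under ∃: (b, c, a)
φA union    = ∃ₛ ((v0 ∈ₛ v2) ∧ₛ (v1 ∈ₛ v0))
-- (POWER) ∀b. b ∈ c → b ∈ a    under ∀: (b, c, a)
φA power    = ∀ₛ ((v0 ∈ₛ v1) ⇒ₛ (v0 ∈ₛ v2))
-- (REPL_φ) (∀x ∈ a ∃!y. φ(x,y,f⃗)) ∧ ∃x ∈ a. φ(x,c,f⃗)
φA (repl φ) = ∀ₛ ((v0 ∈ₛ v2) ⇒ₛ ∃!ₛ (subF σrepl₁ φ))
           ∧ₛ ∃ₛ ((v0 ∈ₛ v2) ∧ₛ subF σrepl₂ φ)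

infixl 7 _·_ _·ₜ_

data Proof : ℕ → ℕ → Set where
  pv     : Fin m → Proof n m
  _·_    : Proof n m → Proof n m → Proof n m
  Λ      : Proof (suc n) m → Proof n m
  ƛ      : Formula n → Proof n (suc m) → Proof n m
  inl    : Proof n m → Proof n m
  inr    : Proof n m → Proof n m
  fst    : Proof n m → Proof n m
  snd    : Proof n m → Proof n m
  pack   : Term n → Proof n m → Proof n m
  _·ₜ_   : Proof n m → Term n → Proof n m
  ⟨_,_⟩  : Proof n m → Proof n m → Proof n m
  case   : Proof n m → Formula n → Proof n (suc m)
                     → Formula n → Proof n (suc m) → Proof n m
  magic  : Proof n m → Proof n m
  letP   : Formula (suc n) → Proof n m
                     → Proof (suc n) (suc m) → Proof n m
  axRep  : Ax k → Term n → Vec (Term n) k → Proof n m → Proof n m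
  axProp : Ax k → Term n → Vec (Term n) k → Proof n m → Proof n m
  ind    : Formula (suc k) → Vec (Term n) k → Proof n m → Proof n m

subPt : (Fin n → Term n') → Proof n m → Proof n' m
subPt σ (pv x)             = pv x
subPt σ (M · N)            = subPt σ M · subPt σ N
subPt σ (Λ M)              = Λ (subPt (liftS σ) M)
subPt σ (ƛ φ M)            = ƛ (subF σ φ) (subPt σ M)
subPt σ (inl M)            = inl (subPt σ M)
subPt σ (inr M)            = inr (subPt σ M)
subPt σ (fst M)            = fst (subPt σ M)
subPt σ (snd M)            = snd (subPt σ M)
subPt σ (pack t M)         = pack (subT σ t) (subPt σ M)
subPt σ (M ·ₜ t)           = subPt σ M ·ₜ subT σ t
subPt σ ⟨ M , N ⟩          = ⟨ subPt σ M , subPt σ N ⟩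
subPt σ (case M φ N ψ O)   = case (subPt σ M) (subF σ φ) (subPt σ N) (subF σ ψ) (subPt σ O)
subPt σ (magic M)          = magic (subPt σ M)
subPt σ (letP φ M N)       = letP (subF (liftS σ) φ) (subPt σ M) (subPt (liftS σ) N)
subPt σ (axRep A t us M)   = axRep A (subT σ t) (subTs σ us) (subPt σ M)
subPt σ (axProp A t us M)  = axProp A (subT σ t) (subTs σ us) (subPt σ M)
subPt σ (ind φ ts M)       = ind φ (subTs σ ts) (subPt σ M)

wkPt : Proof n m → Proof (suc n) m
wkPt = subPt (λ i → var (suc i))

renPp : (Fin m → Fin m') → Proof n m → Proof n m'
renPp ρ (pv x)             = pv (ρ x)
renPp ρ (M · N)            = renPp ρ M · renPp ρ N
renPp ρ (Λ M)              = Λ (renPp ρ M)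
renPp ρ (ƛ φ M)            = ƛ φ (renPp (liftR ρ) M)
renPp ρ (inl M)            = inl (renPp ρ M)
renPp ρ (inr M)            = inr (renPp ρ M)
renPp ρ (fst M)            = fst (renPp ρ M)
renPp ρ (snd M)            = snd (renPp ρ M)
renPp ρ (pack t M)         = pack t (renPp ρ M)
renPp ρ (M ·ₜ t)           = renPp ρ M ·ₜ t
renPp ρ ⟨ M , N ⟩          = ⟨ renPp ρ M , renPp ρ N ⟩
renPp ρ (case M φ N ψ O)   = case (renPp ρ M) φ (renPp (liftR ρ) N) ψ (renPp (liftR ρ) O)
renPp ρ (magic M)          = magic (renPp ρ M)
renPp ρ (letP φ M N)       = letP φ (renPp ρ M) (renPp (liftR ρ) N)
renPp ρ (axRep A t us M)   = axRep A t us (renPp ρ M)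
renPp ρ (axProp A t us M)  = axProp A t us (renPp ρ M)
renPp ρ (ind φ ts M)       = ind φ ts (renPp ρ M)

wkPp : Proof n m → Proof n (suc m)
wkPp = renPp suc

liftP : (Fin m → Proof n m') → Fin (suc m) → Proof n (suc m')
liftP τ zero    = pv zero
liftP τ (suc i) = wkPp (τ i)

subPp : (Fin m → Proof n m') → Proof n m → Proof n m'
subPp τ (pv x)             = τ x
subPp τ (M · N)            = subPp τ M · subPp τ N
subPp τ (Λ M)              = Λ (subPp (λ i → wkPt (τ i)) M)
subPp τ (ƛ φ M)            = ƛ φ (subPp (liftP τ) M)
subPp τ (inl M)            = inl (subPp τ M)
subPp τ (inr M)            = inr (subPp τ M)
subPp τ (fst M)            = fst (subPp τ M)
subPp τ (snd M)            = snd (subPp τ M)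
subPp τ (pack t M)         = pack t (subPp τ M)
subPp τ (M ·ₜ t)           = subPp τ M ·ₜ t
subPp τ ⟨ M , N ⟩          = ⟨ subPp τ M , subPp τ N ⟩
subPp τ (case M φ N ψ O)   = case (subPp τ M) φ (subPp (liftP τ) N) ψ (subPp (liftP τ) O)
subPp τ (magic M)          = magic (subPp τ M)
subPp τ (letP φ M N)       = letP φ (subPp τ M) (subPp (liftP (λ i → wkPt (τ i))) N)
subPp τ (axRep A t us M)   = axRep A t us (subPp τ M)
subPp τ (axProp A t us M)  = axProp A t us (subPp τ M)
subPp τ (ind φ ts M)       = ind φ ts (subPp τ M)

singleP : Proof n m → Fin (suc m) → Proof n m
singleP N zero    = N
singleP N (suc i) = pv i

_[_]p : Proof n (suc m) → Proof n m → Proof n m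
M [ N ]p = subPp (singleP N) M

_[_]t : Proof (suc n) m → Term n → Proof n m
M [ t ]t = subPt (single t) M

infix 2 _⟶_

data _⟶_ : Proof n m → Proof n m → Set where
  β-ƛ      : ∀ {φ} {M : Proof n (suc m)} {N} → (ƛ φ M) · N ⟶ M [ N ]p
  β-Λ      : ∀ {M : Proof (suc n) m} {t} → (Λ M) ·ₜ t ⟶ M [ t ]t
  β-fst    : ∀ {M N : Proof n m} → fst ⟨ M , N ⟩ ⟶ M
  β-snd    : ∀ {M N : Proof n m} → snd ⟨ M , N ⟩ ⟶ N
  β-inl    : ∀ {M : Proof n m} {φ N ψ O} → case (inl M) φ N ψ O ⟶ N [ M ]p
  β-inr    : ∀ {M : Proof n m} {φ N ψ O} → case (inr M) φ N ψ O ⟶ O [ M ]p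
  β-let    : ∀ {φ t} {M : Proof n m} {N} → letP φ (pack t M) N ⟶ (N [ t ]t) [ M ]p
  β-ax     : ∀ {A : Ax k} {t us} {M : Proof n m} → axProp A t us (axRep A t us M) ⟶ M
  β-ind    : ∀ {φ : Formula (suc k)} {ts} {M : Proof n m} →
             ind φ ts M ⟶
               Λ ((wkPt M ·ₜ var zero) ·
                  Λ (ƛ (var zero ∈ₛ var (suc zero))
                       (wkPp (wkPt (wkPt (ind φ ts M))) ·ₜ var zero)))
  ξ-fst    : ∀ {M M' : Proof n m} → M ⟶ M' → fst M ⟶ fst M'
  ξ-snd    : ∀ {M M' : Proof n m} → M ⟶ M' → snd M ⟶ snd M'
  ξ-case   : ∀ {M M' : Proof n m} {φ N ψ O} → M ⟶ M' → case M φ N ψ O ⟶ case M' φ N ψ O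
  ξ-axProp : ∀ {A : Ax k} {t us} {M M' : Proof n m} → M ⟶ M' → axProp A t us M ⟶ axProp A t us M'
  ξ-let    : ∀ {φ} {M M' : Proof n m} {N} → M ⟶ M' → letP φ M N ⟶ letP φ M' N
  ξ-app    : ∀ {M M' N : Proof n m} → M ⟶ M' → M · N ⟶ M' · N
  ξ-appₜ   : ∀ {M M' : Proof n m} {t} → M ⟶ M' → M ·ₜ t ⟶ M' ·ₜ t
  ξ-magic  : ∀ {M M' : Proof n m} → M ⟶ M' → magic M ⟶ magic M'

infix 1 _⊢_∶_

wkΓ : Vec (Formula n) m → Vec (Formula (suc n)) m
wkΓ = V.map wkF

-- ∀c. (∀b. b ∈ c → φ(b, t⃗)) → φ(c, t⃗)
indPremise : Formula (suc k) → Vec (Term n) k → Formula n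
indPremise φ ts =
  ∀ₛ (∀ₛ ((var zero ∈ₛ var (suc zero)) ⇒ₛ inst φ (var zero) (wkTs (wkTs ts)))
      ⇒ₛ inst φ (var zero) (wkTs ts))

indConclusion : Formula (suc k) → Vec (Term n) k → Formula n
indConclusion φ ts = ∀ₛ (inst φ (var zero) (wkTs ts))

data _⊢_∶_ : Vec (Formula n) m → Proof n m → Formula n → Set where
  ty-var    : ∀ {Γ : Vec (Formula n) m} x → Γ ⊢ pv x ∶ lookup Γ x
  ty-ƛ      : ∀ {Γ : Vec (Formula n) m} {φ ψ M} → (φ ∷ Γ) ⊢ M ∶ ψ → Γ ⊢ ƛ φ M ∶ φ ⇒ₛ ψ
  ty-app    : ∀ {Γ : Vec (Formula n) m} {φ ψ M N} → Γ ⊢ M ∶ φ ⇒ₛ ψ → Γ ⊢ N ∶ φ → Γ ⊢ M · N ∶ ψ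
  ty-pair   : ∀ {Γ : Vec (Formula n) m} {φ ψ M N} → Γ ⊢ M ∶ φ → Γ ⊢ N ∶ ψ → Γ ⊢ ⟨ M , N ⟩ ∶ φ ∧ₛ ψ
  ty-fst    : ∀ {Γ : Vec (Formula n) m} {φ ψ M} → Γ ⊢ M ∶ φ ∧ₛ ψ → Γ ⊢ fst M ∶ φ
  ty-snd    : ∀ {Γ : Vec (Formula n) m} {φ ψ M} → Γ ⊢ M ∶ φ ∧ₛ ψ → Γ ⊢ snd M ∶ ψ
  ty-inl    : ∀ {Γ : Vec (Formula n) m} {φ ψ M} → Γ ⊢ M ∶ φ → Γ ⊢ inl M ∶ φ ∨ₛ ψ
  ty-inr    : ∀ {Γ : Vec (Formula n) m} {φ ψ M} → Γ ⊢ M ∶ ψ → Γ ⊢ inr M ∶ φ ∨ₛ ψ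
  ty-case   : ∀ {Γ : Vec (Formula n) m} {φ ψ ϑ M N O} →
              Γ ⊢ M ∶ φ ∨ₛ ψ → (φ ∷ Γ) ⊢ N ∶ ϑ → (ψ ∷ Γ) ⊢ O ∶ ϑ →
              Γ ⊢ case M φ N ψ O ∶ ϑ
  -- ∀-intro: the side condition "a not free in Γ" is built in by weakening Γ
  ty-Λ      : ∀ {Γ : Vec (Formula n) m} {φ M} → wkΓ Γ ⊢ M ∶ φ → Γ ⊢ Λ M ∶ ∀ₛ φ
  ty-appₜ   : ∀ {Γ : Vec (Formula n) m} {φ M} t → Γ ⊢ M ∶ ∀ₛ φ → Γ ⊢ M ·ₜ t ∶ φ [ t ]F
  ty-pack   : ∀ {Γ : Vec (Formula n) m} {φ M} t → Γ ⊢ M ∶ φ [ t ]F → Γ ⊢ pack t M ∶ ∃ₛ φ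
  -- ∃-elim: "a not free in Γ, ψ" built in by weakening Γ and ψ
  ty-let    : ∀ {Γ : Vec (Formula n) m} {φ ψ M N} →
              Γ ⊢ M ∶ ∃ₛ φ → (φ ∷ wkΓ Γ) ⊢ N ∶ wkF ψ → Γ ⊢ letP φ M N ∶ ψ
  ty-magic  : ∀ {Γ : Vec (Formula n) m} {φ M} → Γ ⊢ M ∶ ⊥ₛ → Γ ⊢ magic M ∶ φ
  ty-axRep  : ∀ {Γ : Vec (Formula n) m} {A : Ax k} {t us M} →
              Γ ⊢ M ∶ inst (φA A) t us → Γ ⊢ axRep A t us M ∶ t ∈ₛ tA A us
  ty-axProp : ∀ {Γ : Vec (Formula n) m} {A : Ax k} {t us M} →
              Γ ⊢ M ∶ t ∈ₛ tA A us → Γ ⊢ axProp A t us M ∶ inst (φA A) t us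
  ty-ind    : ∀ {Γ : Vec (Formula n) m} {φ : Formula (suc k)} {ts M} →
              Γ ⊢ M ∶ indPremise φ ts → Γ ⊢ ind φ ts M ∶ indConclusion φ ts

module Submission where

-- The congruence
-- rules follow from the induction hypothesis; each β-rule is an instance of a
-- substitution lemma, one for proof variables and one for first-order variables.
-- The latter needs first-order substitution to commute with everything the typing
-- rules compute on formulas: weakening, instantiation φ[a := t], the axiom
-- templates φ_A and the premise and conclusion of ∈-induction.  Templates are
-- closed apart from their parameters, so a substitution passes through them to the
-- argument vector.  The unfolding of ind is typed by instantiating the premise at a
-- fresh c and feeding it the recursive call, weakened past c, b and x : b ∈ c.

open import Defs
open import Data.Nat using (ℕ; zero; suc)
open import Data.Fin using (Fin; zero; suc)
open import Data.Vec using (Vec; []; _∷_; lookup)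
import Data.Vec as V
open import Data.Vec.Properties using (lookup-map; map-cong; map-∘; map-id)
open import Function using (_∘_)
open import Relation.Binary.PropositionalEquality
open ≡-Reasoning

private
  variable
    n n' n'' m m' k : ℕ

-- Substitution algebra for first-order terms

mutual
  subT-cong : {σ σ' : Fin n → Term n'} → (∀ i → σ i ≡ σ' i) → (t : Term n) → subT σ t ≡ subT σ' t
  subT-cong e (var i)        = e i
  subT-cong e ∅ₛ             = refl
  subT-cong e ωₛ             = refl
  subT-cong e (upair t u)    = cong₂ upair (subT-cong e t) (subT-cong e u)
  subT-cong e (⋃ₛ t)         = cong ⋃ₛ (subT-cong e t)
  subT-cong e (Pₛ t)         = cong Pₛ (subT-cong e t)
  subT-cong e (sepT φ t us)  = cong₂ (sepT φ) (subT-cong e t) (subTs-cong e us)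
  subT-cong e (replT φ t us) = cong₂ (replT φ) (subT-cong e t) (subTs-cong e us)

  subTs-cong : {σ σ' : Fin n → Term n'} → (∀ i → σ i ≡ σ' i) → (ts : Vec (Term n) k) →
               subTs σ ts ≡ subTs σ' ts
  subTs-cong e []       = refl
  subTs-cong e (t ∷ ts) = cong₂ _∷_ (subT-cong e t) (subTs-cong e ts)

mutual
  renT-as-subT : (ρ : Fin n → Fin n') (t : Term n) → renT ρ t ≡ subT (var ∘ ρ) t
  renT-as-subT ρ (var i)        = refl
  renT-as-subT ρ ∅ₛ             = refl
  renT-as-subT ρ ωₛ             = refl
  renT-as-subT ρ (upair t u)    = cong₂ upair (renT-as-subT ρ t) (renT-as-subT ρ u)
  renT-as-subT ρ (⋃ₛ t)         = cong ⋃ₛ (renT-as-subT ρ t)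
  renT-as-subT ρ (Pₛ t)         = cong Pₛ (renT-as-subT ρ t)
  renT-as-subT ρ (sepT φ t us)  = cong₂ (sepT φ) (renT-as-subT ρ t) (renTs-as-subTs ρ us)
  renT-as-subT ρ (replT φ t us) = cong₂ (replT φ) (renT-as-subT ρ t) (renTs-as-subTs ρ us)

  renTs-as-subTs : (ρ : Fin n → Fin n') (ts : Vec (Term n) k) → renTs ρ ts ≡ subTs (var ∘ ρ) ts
  renTs-as-subTs ρ []       = refl
  renTs-as-subTs ρ (t ∷ ts) = cong₂ _∷_ (renT-as-subT ρ t) (renTs-as-subTs ρ ts)

mutual
  subT-∘ : (σ : Fin n' → Term n'') (τ : Fin n → Term n') (t : Term n) →
           subT σ (subT τ t) ≡ subT (subT σ ∘ τ) t
  subT-∘ σ τ (var i)        = refl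
  subT-∘ σ τ ∅ₛ             = refl
  subT-∘ σ τ ωₛ             = refl
  subT-∘ σ τ (upair t u)    = cong₂ upair (subT-∘ σ τ t) (subT-∘ σ τ u)
  subT-∘ σ τ (⋃ₛ t)         = cong ⋃ₛ (subT-∘ σ τ t)
  subT-∘ σ τ (Pₛ t)         = cong Pₛ (subT-∘ σ τ t)
  subT-∘ σ τ (sepT φ t us)  = cong₂ (sepT φ) (subT-∘ σ τ t) (subTs-∘ σ τ us)
  subT-∘ σ τ (replT φ t us) = cong₂ (replT φ) (subT-∘ σ τ t) (subTs-∘ σ τ us)

  subTs-∘ : (σ : Fin n' → Term n'') (τ : Fin n → Term n') (ts : Vec (Term n) k) →
            subTs σ (subTs τ ts) ≡ subTs (subT σ ∘ τ) ts
  subTs-∘ σ τ []       = refl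
  subTs-∘ σ τ (t ∷ ts) = cong₂ _∷_ (subT-∘ σ τ t) (subTs-∘ σ τ ts)

mutual
  subT-id : (t : Term n) → subT var t ≡ t
  subT-id (var i)        = refl
  subT-id ∅ₛ             = refl
  subT-id ωₛ             = refl
  subT-id (upair t u)    = cong₂ upair (subT-id t) (subT-id u)
  subT-id (⋃ₛ t)         = cong ⋃ₛ (subT-id t)
  subT-id (Pₛ t)         = cong Pₛ (subT-id t)
  subT-id (sepT φ t us)  = cong₂ (sepT φ) (subT-id t) (subTs-id us)
  subT-id (replT φ t us) = cong₂ (replT φ) (subT-id t) (subTs-id us)

  subTs-id : (ts : Vec (Term n) k) → subTs var ts ≡ ts
  subTs-id []       = refl
  subTs-id (t ∷ ts) = cong₂ _∷_ (subT-id t) (subTs-id ts)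

lookup-subTs : (σ : Fin n → Term n') (ts : Vec (Term n) k) (i : Fin k) →
               lookup (subTs σ ts) i ≡ subT σ (lookup ts i)
lookup-subTs σ (t ∷ ts) zero    = refl
lookup-subTs σ (t ∷ ts) (suc i) = lookup-subTs σ ts i

subT-wkT : (σ : Fin n → Term n') (t : Term n) → subT (liftS σ) (wkT t) ≡ wkT (subT σ t)
subT-wkT σ t = begin
  subT (liftS σ) (wkT t)              ≡⟨ cong (subT (liftS σ)) (renT-as-subT suc t) ⟩
  subT (liftS σ) (subT (var ∘ suc) t) ≡⟨ subT-∘ (liftS σ) (var ∘ suc) t ⟩
  subT (wkT ∘ σ) t                    ≡⟨ subT-cong (renT-as-subT suc ∘ σ) t ⟩
  subT (subT (var ∘ suc) ∘ σ) t       ≡⟨ subT-∘ (var ∘ suc) σ t ⟨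
  subT (var ∘ suc) (subT σ t)         ≡⟨ renT-as-subT suc (subT σ t) ⟨
  wkT (subT σ t)                      ∎

subTs-wkTs : (σ : Fin n → Term n') (ts : Vec (Term n) k) → subTs (liftS σ) (wkTs ts) ≡ wkTs (subTs σ ts)
subTs-wkTs σ []       = refl
subTs-wkTs σ (t ∷ ts) = cong₂ _∷_ (subT-wkT σ t) (subTs-wkTs σ ts)

subT-single-wkT : (t u : Term n) → subT (single t) (wkT u) ≡ u
subT-single-wkT t u = begin
  subT (single t) (wkT u)              ≡⟨ cong (subT (single t)) (renT-as-subT suc u) ⟩
  subT (single t) (subT (var ∘ suc) u) ≡⟨ subT-∘ (single t) (var ∘ suc) u ⟩
  subT var u                           ≡⟨ subT-id u ⟩
  u                                    ∎

liftS-cong : {σ σ' : Fin n → Term n'} → (∀ i → σ i ≡ σ' i) → ∀ i → liftS σ i ≡ liftS σ' i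
liftS-cong e zero    = refl
liftS-cong e (suc i) = cong wkT (e i)

liftS-var : (ρ : Fin n → Fin n') → ∀ i → liftS (var ∘ ρ) i ≡ var (liftR ρ i)
liftS-var ρ zero    = refl
liftS-var ρ (suc i) = refl

liftS-∘ : (σ : Fin n' → Term n'') (τ : Fin n → Term n') → ∀ i →
          subT (liftS σ) (liftS τ i) ≡ liftS (subT σ ∘ τ) i
liftS-∘ σ τ zero    = refl
liftS-∘ σ τ (suc i) = subT-wkT σ (τ i)

liftS-id : ∀ i → liftS {n} var i ≡ var i
liftS-id zero    = refl
liftS-id (suc i) = refl

-- Substitution algebra for formulas

subF-cong : {σ σ' : Fin n → Term n'} → (∀ i → σ i ≡ σ' i) → (φ : Formula n) → subF σ φ ≡ subF σ' φ
subF-cong e (t ∈ₛ u) = cong₂ _∈ₛ_ (subT-cong e t) (subT-cong e u)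
subF-cong e ⊥ₛ       = refl
subF-cong e (φ ∧ₛ ψ) = cong₂ _∧ₛ_ (subF-cong e φ) (subF-cong e ψ)
subF-cong e (φ ∨ₛ ψ) = cong₂ _∨ₛ_ (subF-cong e φ) (subF-cong e ψ)
subF-cong e (φ ⇒ₛ ψ) = cong₂ _⇒ₛ_ (subF-cong e φ) (subF-cong e ψ)
subF-cong e (∀ₛ φ)   = cong ∀ₛ (subF-cong (liftS-cong e) φ)
subF-cong e (∃ₛ φ)   = cong ∃ₛ (subF-cong (liftS-cong e) φ)

renF-as-subF : (ρ : Fin n → Fin n') (φ : Formula n) → renF ρ φ ≡ subF (var ∘ ρ) φ
renF-as-subF ρ (t ∈ₛ u) = cong₂ _∈ₛ_ (renT-as-subT ρ t) (renT-as-subT ρ u)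
renF-as-subF ρ ⊥ₛ       = refl
renF-as-subF ρ (φ ∧ₛ ψ) = cong₂ _∧ₛ_ (renF-as-subF ρ φ) (renF-as-subF ρ ψ)
renF-as-subF ρ (φ ∨ₛ ψ) = cong₂ _∨ₛ_ (renF-as-subF ρ φ) (renF-as-subF ρ ψ)
renF-as-subF ρ (φ ⇒ₛ ψ) = cong₂ _⇒ₛ_ (renF-as-subF ρ φ) (renF-as-subF ρ ψ)
renF-as-subF ρ (∀ₛ φ)   =
  cong ∀ₛ (trans (renF-as-subF (liftR ρ) φ) (subF-cong (sym ∘ liftS-var ρ) φ))
renF-as-subF ρ (∃ₛ φ)   =
  cong ∃ₛ (trans (renF-as-subF (liftR ρ) φ) (subF-cong (sym ∘ liftS-var ρ) φ))

subF-∘ : (σ : Fin n' → Term n'') (τ : Fin n → Term n') (φ : Formula n) →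
         subF σ (subF τ φ) ≡ subF (subT σ ∘ τ) φ
subF-∘ σ τ (t ∈ₛ u) = cong₂ _∈ₛ_ (subT-∘ σ τ t) (subT-∘ σ τ u)
subF-∘ σ τ ⊥ₛ       = refl
subF-∘ σ τ (φ ∧ₛ ψ) = cong₂ _∧ₛ_ (subF-∘ σ τ φ) (subF-∘ σ τ ψ)
subF-∘ σ τ (φ ∨ₛ ψ) = cong₂ _∨ₛ_ (subF-∘ σ τ φ) (subF-∘ σ τ ψ)
subF-∘ σ τ (φ ⇒ₛ ψ) = cong₂ _⇒ₛ_ (subF-∘ σ τ φ) (subF-∘ σ τ ψ)
subF-∘ σ τ (∀ₛ φ)   = cong ∀ₛ (trans (subF-∘ (liftS σ) (liftS τ) φ) (subF-cong (liftS-∘ σ τ) φ))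
subF-∘ σ τ (∃ₛ φ)   = cong ∃ₛ (trans (subF-∘ (liftS σ) (liftS τ) φ) (subF-cong (liftS-∘ σ τ) φ))

subF-id : (φ : Formula n) → subF var φ ≡ φ
subF-id (t ∈ₛ u) = cong₂ _∈ₛ_ (subT-id t) (subT-id u)
subF-id ⊥ₛ       = refl
subF-id (φ ∧ₛ ψ) = cong₂ _∧ₛ_ (subF-id φ) (subF-id ψ)
subF-id (φ ∨ₛ ψ) = cong₂ _∨ₛ_ (subF-id φ) (subF-id ψ)
subF-id (φ ⇒ₛ ψ) = cong₂ _⇒ₛ_ (subF-id φ) (subF-id ψ)
subF-id (∀ₛ φ)   = cong ∀ₛ (trans (subF-cong liftS-id φ) (subF-id φ))
subF-id (∃ₛ φ)   = cong ∃ₛ (trans (subF-cong liftS-id φ) (subF-id φ))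

subF-wkF : (σ : Fin n → Term n') (φ : Formula n) → subF (liftS σ) (wkF φ) ≡ wkF (subF σ φ)
subF-wkF σ φ = begin
  subF (liftS σ) (wkF φ)              ≡⟨ cong (subF (liftS σ)) (renF-as-subF suc φ) ⟩
  subF (liftS σ) (subF (var ∘ suc) φ) ≡⟨ subF-∘ (liftS σ) (var ∘ suc) φ ⟩
  subF (wkT ∘ σ) φ                    ≡⟨ subF-cong (renT-as-subT suc ∘ σ) φ ⟩
  subF (subT (var ∘ suc) ∘ σ) φ       ≡⟨ subF-∘ (var ∘ suc) σ φ ⟨
  subF (var ∘ suc) (subF σ φ)         ≡⟨ renF-as-subF suc (subF σ φ) ⟨
  wkF (subF σ φ)                      ∎

wkF-[]F : (t : Term n) (φ : Formula n) → wkF φ [ t ]F ≡ φ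
wkF-[]F t φ = begin
  subF (single t) (wkF φ)              ≡⟨ cong (subF (single t)) (renF-as-subF suc φ) ⟩
  subF (single t) (subF (var ∘ suc) φ) ≡⟨ subF-∘ (single t) (var ∘ suc) φ ⟩
  subF var φ                           ≡⟨ subF-id φ ⟩
  φ                                    ∎

subF-[]F : (σ : Fin n → Term n') (t : Term n) (φ : Formula (suc n)) →
           subF σ (φ [ t ]F) ≡ subF (liftS σ) φ [ subT σ t ]F
subF-[]F σ t φ = begin
  subF σ (subF (single t) φ)                  ≡⟨ subF-∘ σ (single t) φ ⟩
  subF (subT σ ∘ single t) φ                  ≡⟨ subF-cong pointwise φ ⟩
  subF (subT (single (subT σ t)) ∘ liftS σ) φ ≡⟨ subF-∘ (single (subT σ t)) (liftS σ) φ ⟨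
  subF (single (subT σ t)) (subF (liftS σ) φ) ∎
  where
  pointwise : ∀ i → subT σ (single t i) ≡ subT (single (subT σ t)) (liftS σ i)
  pointwise zero    = refl
  pointwise (suc i) = sym (subT-single-wkT (subT σ t) (σ i))

liftR-suc-[var0]F : (φ : Formula (suc n)) → renF (liftR suc) φ [ var zero ]F ≡ φ
liftR-suc-[var0]F φ = begin
  subF (single (var zero)) (renF (liftR suc) φ)            ≡⟨ cong (subF (single (var zero))) (renF-as-subF (liftR suc) φ) ⟩
  subF (single (var zero)) (subF (var ∘ liftR suc) φ)      ≡⟨ subF-∘ (single (var zero)) (var ∘ liftR suc) φ ⟩
  subF (subT (single (var zero)) ∘ var ∘ liftR suc) φ      ≡⟨ subF-cong pointwise φ ⟩
  subF var φ                                               ≡⟨ subF-id φ ⟩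
  φ                                                        ∎
  where
  pointwise : ∀ i → subT (single (var zero)) (var (liftR suc i)) ≡ var i
  pointwise zero    = refl
  pointwise (suc i) = refl

-- Substitution through templates, axioms and the induction scheme

subF-inst : (σ : Fin n → Term n') (φ : Formula (suc k)) (t : Term n) (us : Vec (Term n) k) →
            subF σ (inst φ t us) ≡ inst φ (subT σ t) (subTs σ us)
subF-inst σ φ t us = trans (subF-∘ σ (lookup (t ∷ us)) φ) (subF-cong pointwise φ)
  where
  pointwise : ∀ i → subT σ (lookup (t ∷ us) i) ≡ lookup (subT σ t ∷ subTs σ us) i
  pointwise zero    = refl
  pointwise (suc i) = sym (lookup-subTs σ us i)

subF-inst-var0 : (σ : Fin n → Term n') (φ : Formula (suc k)) (ts : Vec (Term n) k) →
                 subF (liftS σ) (inst φ (var zero) (wkTs ts)) ≡ inst φ (var zero) (wkTs (subTs σ ts))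
subF-inst-var0 σ φ ts =
  trans (subF-inst (liftS σ) φ (var zero) (wkTs ts)) (cong (inst φ (var zero)) (subTs-wkTs σ ts))

subT-tA : (σ : Fin n → Term n') (A : Ax k) (us : Vec (Term n) k) → subT σ (tA A us) ≡ tA A (subTs σ us)
subT-tA σ empty    []           = refl
subT-tA σ pair     (a ∷ b ∷ []) = refl
subT-tA σ inf      []           = refl
subT-tA σ (sep φ)  (a ∷ fs)     = refl
subT-tA σ union    (a ∷ [])     = refl
subT-tA σ power    (a ∷ [])     = refl
subT-tA σ (repl φ) (a ∷ fs)     = refl

subF-indPremise : (σ : Fin n → Term n') (φ : Formula (suc k)) (ts : Vec (Term n) k) →
                  subF σ (indPremise φ ts) ≡ indPremise φ (subTs σ ts)
subF-indPremise σ φ ts =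
  cong ∀ₛ (cong₂ _⇒ₛ_
    (cong ∀ₛ (cong ((var zero ∈ₛ var (suc zero)) ⇒ₛ_)
      (trans (subF-inst-var0 (liftS σ) φ (wkTs ts))
             (cong (inst φ (var zero) ∘ wkTs) (subTs-wkTs σ ts)))))
    (subF-inst-var0 σ φ ts))

subF-indConclusion : (σ : Fin n → Term n') (φ : Formula (suc k)) (ts : Vec (Term n) k) →
                     subF σ (indConclusion φ ts) ≡ indConclusion φ (subTs σ ts)
subF-indConclusion σ φ ts = cong ∀ₛ (subF-inst-var0 σ φ ts)

-- Substituting first-order variables in derivations

cast : {Γ Γ' : Vec (Formula n) m} {M : Proof n m} {φ φ' : Formula n} →
       Γ ≡ Γ' → φ ≡ φ' → Γ ⊢ M ∶ φ → Γ' ⊢ M ∶ φ'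
cast refl refl d = d

map-wkΓ : {f : Formula (suc n) → Formula n'} {g : Formula n → Formula n'} →
          (∀ φ → f (wkF φ) ≡ g φ) → (Γ : Vec (Formula n) m) → V.map f (wkΓ Γ) ≡ V.map g Γ
map-wkΓ {f = f} eq Γ = trans (sym (map-∘ f wkF Γ)) (map-cong eq Γ)

lifted-context : (σ : Fin n → Term n') (Γ : Vec (Formula n) m) →
                 V.map (subF (liftS σ)) (wkΓ Γ) ≡ wkΓ (V.map (subF σ) Γ)
lifted-context σ Γ = trans (map-wkΓ (subF-wkF σ) Γ) (map-∘ wkF (subF σ) Γ)

⊢-subPt : {Γ : Vec (Formula n) m} {M : Proof n m} {φ : Formula n} (σ : Fin n → Term n') →
          Γ ⊢ M ∶ φ → V.map (subF σ) Γ ⊢ subPt σ M ∶ subF σ φ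
⊢-subPt {Γ = Γ} σ (ty-var x) = cast refl (lookup-map x (subF σ) Γ) (ty-var x)
⊢-subPt σ (ty-ƛ d)         = ty-ƛ (⊢-subPt σ d)
⊢-subPt σ (ty-app d e)     = ty-app (⊢-subPt σ d) (⊢-subPt σ e)
⊢-subPt σ (ty-pair d e)    = ty-pair (⊢-subPt σ d) (⊢-subPt σ e)
⊢-subPt σ (ty-fst d)       = ty-fst (⊢-subPt σ d)
⊢-subPt σ (ty-snd d)       = ty-snd (⊢-subPt σ d)
⊢-subPt σ (ty-inl d)       = ty-inl (⊢-subPt σ d)
⊢-subPt σ (ty-inr d)       = ty-inr (⊢-subPt σ d)
⊢-subPt σ (ty-case d e f)  = ty-case (⊢-subPt σ d) (⊢-subPt σ e) (⊢-subPt σ f)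
⊢-subPt {Γ = Γ} σ (ty-Λ d) = ty-Λ (cast (lifted-context σ Γ) refl (⊢-subPt (liftS σ) d))
⊢-subPt σ (ty-appₜ {φ = φ} t d) =
  cast refl (sym (subF-[]F σ t φ)) (ty-appₜ (subT σ t) (⊢-subPt σ d))
⊢-subPt σ (ty-pack {φ = φ} t d) =
  ty-pack (subT σ t) (cast refl (subF-[]F σ t φ) (⊢-subPt σ d))
⊢-subPt {Γ = Γ} σ (ty-let {ψ = ψ} d e) =
  ty-let (⊢-subPt σ d) (cast (cong (_ ∷_) (lifted-context σ Γ)) (subF-wkF σ ψ) (⊢-subPt (liftS σ) e))
⊢-subPt σ (ty-magic d)     = ty-magic (⊢-subPt σ d)
⊢-subPt σ (ty-axRep {A = A} {t = t} {us = us} d) =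
  cast refl (cong (subT σ t ∈ₛ_) (sym (subT-tA σ A us)))
    (ty-axRep (cast refl (subF-inst σ (φA A) t us) (⊢-subPt σ d)))
⊢-subPt σ (ty-axProp {A = A} {t = t} {us = us} d) =
  cast refl (sym (subF-inst σ (φA A) t us))
    (ty-axProp (cast refl (cong (subT σ t ∈ₛ_) (subT-tA σ A us)) (⊢-subPt σ d)))
⊢-subPt σ (ty-ind {φ = φ} {ts = ts} d) =
  cast refl (sym (subF-indConclusion σ φ ts))
    (ty-ind (cast refl (subF-indPremise σ φ ts) (⊢-subPt σ d)))


⊢-wkPt : {Γ : Vec (Formula n) m} {M : Proof n m} {φ : Formula n} →
         Γ ⊢ M ∶ φ → wkΓ Γ ⊢ wkPt M ∶ wkF φ
⊢-wkPt {Γ = Γ} {φ = φ} d =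
  cast (map-cong (sym ∘ renF-as-subF suc) Γ) (sym (renF-as-subF suc φ)) (⊢-subPt (var ∘ suc) d)

wkΓ-[]F : (t : Term n) (Γ : Vec (Formula n) m) → V.map (_[ t ]F) (wkΓ Γ) ≡ Γ
wkΓ-[]F t Γ = trans (map-wkΓ (wkF-[]F t) Γ) (map-id Γ)

⊢-[]t : {Γ : Vec (Formula n) m} {M : Proof (suc n) m} {φ : Formula (suc n)} (t : Term n) →
        wkΓ Γ ⊢ M ∶ φ → Γ ⊢ M [ t ]t ∶ φ [ t ]F
⊢-[]t {Γ = Γ} t d = cast (wkΓ-[]F t Γ) refl (⊢-subPt (single t) d)

-- Renaming and substituting proof variables in derivations

infix 1 _⊢ʳ_∶_ _⊢ˢ_∶_

record _⊢ʳ_∶_ (Δ : Vec (Formula n) m') (ρ : Fin m → Fin m') (Γ : Vec (Formula n) m) : Set where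
  constructor mkʳ
  field ⊢ʳ-lookup : ∀ x → lookup Δ (ρ x) ≡ lookup Γ x

record _⊢ˢ_∶_ (Δ : Vec (Formula n) m') (τ : Fin m → Proof n m') (Γ : Vec (Formula n) m) : Set where
  constructor mkˢ
  field ⊢ˢ-lookup : ∀ x → Δ ⊢ τ x ∶ lookup Γ x

open _⊢ʳ_∶_
open _⊢ˢ_∶_

⊢ʳ-liftR : {Γ : Vec (Formula n) m} {Δ : Vec (Formula n) m'} {ρ : Fin m → Fin m'} (φ : Formula n) →
           Δ ⊢ʳ ρ ∶ Γ → (φ ∷ Δ) ⊢ʳ liftR ρ ∶ (φ ∷ Γ)
⊢ʳ-liftR φ e = mkʳ λ where
  zero    → refl
  (suc x) → ⊢ʳ-lookup e x

⊢ʳ-wkΓ : {Γ : Vec (Formula n) m} {Δ : Vec (Formula n) m'} {ρ : Fin m → Fin m'} →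
         Δ ⊢ʳ ρ ∶ Γ → wkΓ Δ ⊢ʳ ρ ∶ wkΓ Γ
⊢ʳ-wkΓ {Γ = Γ} {Δ} {ρ} e = mkʳ λ x → begin
  lookup (wkΓ Δ) (ρ x) ≡⟨ lookup-map (ρ x) wkF Δ ⟩
  wkF (lookup Δ (ρ x)) ≡⟨ cong wkF (⊢ʳ-lookup e x) ⟩
  wkF (lookup Γ x)     ≡⟨ lookup-map x wkF Γ ⟨
  lookup (wkΓ Γ) x     ∎

⊢-renPp : {Γ : Vec (Formula n) m} {Δ : Vec (Formula n) m'} {M : Proof n m} {φ : Formula n}
          {ρ : Fin m → Fin m'} → Δ ⊢ʳ ρ ∶ Γ → Γ ⊢ M ∶ φ → Δ ⊢ renPp ρ M ∶ φ
⊢-renPp {ρ = ρ} e (ty-var x) = cast refl (⊢ʳ-lookup e x) (ty-var (ρ x))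
⊢-renPp e (ty-ƛ d)        = ty-ƛ (⊢-renPp (⊢ʳ-liftR _ e) d)
⊢-renPp e (ty-app d d')   = ty-app (⊢-renPp e d) (⊢-renPp e d')
⊢-renPp e (ty-pair d d')  = ty-pair (⊢-renPp e d) (⊢-renPp e d')
⊢-renPp e (ty-fst d)      = ty-fst (⊢-renPp e d)
⊢-renPp e (ty-snd d)      = ty-snd (⊢-renPp e d)
⊢-renPp e (ty-inl d)      = ty-inl (⊢-renPp e d)
⊢-renPp e (ty-inr d)      = ty-inr (⊢-renPp e d)
⊢-renPp e (ty-case d f g) = ty-case (⊢-renPp e d) (⊢-renPp (⊢ʳ-liftR _ e) f) (⊢-renPp (⊢ʳ-liftR _ e) g)
⊢-renPp e (ty-Λ d)        = ty-Λ (⊢-renPp (⊢ʳ-wkΓ e) d)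
⊢-renPp e (ty-appₜ t d)   = ty-appₜ t (⊢-renPp e d)
⊢-renPp e (ty-pack t d)   = ty-pack t (⊢-renPp e d)
⊢-renPp e (ty-let d f)    = ty-let (⊢-renPp e d) (⊢-renPp (⊢ʳ-liftR _ (⊢ʳ-wkΓ e)) f)
⊢-renPp e (ty-magic d)    = ty-magic (⊢-renPp e d)
⊢-renPp e (ty-axRep d)    = ty-axRep (⊢-renPp e d)
⊢-renPp e (ty-axProp d)   = ty-axProp (⊢-renPp e d)
⊢-renPp e (ty-ind d)      = ty-ind (⊢-renPp e d)

⊢-wkPp : {Γ : Vec (Formula n) m} {M : Proof n m} {φ : Formula n} (ψ : Formula n) →
         Γ ⊢ M ∶ φ → (ψ ∷ Γ) ⊢ wkPp M ∶ φ
⊢-wkPp ψ = ⊢-renPp (mkʳ λ _ → refl)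

⊢ˢ-liftP : {Γ : Vec (Formula n) m} {Δ : Vec (Formula n) m'} {τ : Fin m → Proof n m'} (φ : Formula n) →
           Δ ⊢ˢ τ ∶ Γ → (φ ∷ Δ) ⊢ˢ liftP τ ∶ (φ ∷ Γ)
⊢ˢ-liftP φ e = mkˢ λ where
  zero    → ty-var zero
  (suc x) → ⊢-wkPp φ (⊢ˢ-lookup e x)

⊢ˢ-wkPt : {Γ : Vec (Formula n) m} {Δ : Vec (Formula n) m'} {τ : Fin m → Proof n m'} →
          Δ ⊢ˢ τ ∶ Γ → wkΓ Δ ⊢ˢ wkPt ∘ τ ∶ wkΓ Γ
⊢ˢ-wkPt {Γ = Γ} e = mkˢ λ x → cast refl (sym (lookup-map x wkF Γ)) (⊢-wkPt (⊢ˢ-lookup e x))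

⊢-subPp : {Γ : Vec (Formula n) m} {Δ : Vec (Formula n) m'} {M : Proof n m} {φ : Formula n}
          {τ : Fin m → Proof n m'} → Δ ⊢ˢ τ ∶ Γ → Γ ⊢ M ∶ φ → Δ ⊢ subPp τ M ∶ φ
⊢-subPp e (ty-var x)      = ⊢ˢ-lookup e x
⊢-subPp e (ty-ƛ d)        = ty-ƛ (⊢-subPp (⊢ˢ-liftP _ e) d)
⊢-subPp e (ty-app d d')   = ty-app (⊢-subPp e d) (⊢-subPp e d')
⊢-subPp e (ty-pair d d')  = ty-pair (⊢-subPp e d) (⊢-subPp e d')
⊢-subPp e (ty-fst d)      = ty-fst (⊢-subPp e d)
⊢-subPp e (ty-snd d)      = ty-snd (⊢-subPp e d)
⊢-subPp e (ty-inl d)      = ty-inl (⊢-subPp e d)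
⊢-subPp e (ty-inr d)      = ty-inr (⊢-subPp e d)
⊢-subPp e (ty-case d f g) = ty-case (⊢-subPp e d) (⊢-subPp (⊢ˢ-liftP _ e) f) (⊢-subPp (⊢ˢ-liftP _ e) g)
⊢-subPp e (ty-Λ d)        = ty-Λ (⊢-subPp (⊢ˢ-wkPt e) d)
⊢-subPp e (ty-appₜ t d)   = ty-appₜ t (⊢-subPp e d)
⊢-subPp e (ty-pack t d)   = ty-pack t (⊢-subPp e d)
⊢-subPp e (ty-let d f)    = ty-let (⊢-subPp e d) (⊢-subPp (⊢ˢ-liftP _ (⊢ˢ-wkPt e)) f)
⊢-subPp e (ty-magic d)    = ty-magic (⊢-subPp e d)
⊢-subPp e (ty-axRep d)    = ty-axRep (⊢-subPp e d)
⊢-subPp e (ty-axProp d)   = ty-axProp (⊢-subPp e d)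
⊢-subPp e (ty-ind d)      = ty-ind (⊢-subPp e d)

⊢ˢ-singleP : {Γ : Vec (Formula n) m} {N : Proof n m} {φ : Formula n} →
             Γ ⊢ N ∶ φ → Γ ⊢ˢ singleP N ∶ (φ ∷ Γ)
⊢ˢ-singleP e = mkˢ λ where
  zero    → e
  (suc x) → ty-var x

⊢-[]p : {Γ : Vec (Formula n) m} {M : Proof n (suc m)} {N : Proof n m} {φ ψ : Formula n} →
        (φ ∷ Γ) ⊢ M ∶ ψ → Γ ⊢ N ∶ φ → Γ ⊢ M [ N ]p ∶ ψ
⊢-[]p d e = ⊢-subPp (⊢ˢ-singleP e) d

-- Unfolding ∈-induction

liftR-suc-inst-var0 : (φ : Formula (suc k)) (ts : Vec (Term n) k) →
                      renF (liftR suc) (inst φ (var zero) (wkTs ts)) ≡ inst φ (var zero) (wkTs (wkTs ts))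
liftR-suc-inst-var0 φ ts = begin
  renF (liftR suc) (inst φ (var zero) (wkTs ts))           ≡⟨ renF-as-subF (liftR suc) _ ⟩
  subF (var ∘ liftR suc) (inst φ (var zero) (wkTs ts))     ≡⟨ subF-cong (sym ∘ liftS-var suc) _ ⟩
  subF (liftS (var ∘ suc)) (inst φ (var zero) (wkTs ts))   ≡⟨ subF-inst-var0 (var ∘ suc) φ ts ⟩
  inst φ (var zero) (wkTs (subTs (var ∘ suc) ts))          ≡⟨ cong (inst φ (var zero) ∘ wkTs) (renTs-as-subTs suc ts) ⟨
  inst φ (var zero) (wkTs (wkTs ts))                       ∎

⊢-ind-unfold : {Γ : Vec (Formula n) m} {φ : Formula (suc k)} {ts : Vec (Term n) k} {M : Proof n m} →
               Γ ⊢ M ∶ indPremise φ ts →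
               Γ ⊢ Λ ((wkPt M ·ₜ var zero) ·
                      Λ (ƛ (var zero ∈ₛ var (suc zero))
                           (wkPp (wkPt (wkPt (ind φ ts M))) ·ₜ var zero)))
                 ∶ indConclusion φ ts
⊢-ind-unfold {φ = φ} {ts} d =
  ty-Λ (ty-app (cast refl (liftR-suc-[var0]F _) (ty-appₜ (var zero) (⊢-wkPt d)))
               (ty-Λ (ty-ƛ (cast refl recursive-call-type
                 (ty-appₜ (var zero) (⊢-wkPp _ (⊢-wkPt (⊢-wkPt (ty-ind d)))))))))
  where
  recursive-call-type : renF (liftR suc) (renF (liftR suc) (inst φ (var zero) (wkTs ts))) [ var zero ]F
                          ≡ inst φ (var zero) (wkTs (wkTs ts))
  recursive-call-type =
    trans (liftR-suc-[var0]F _) (liftR-suc-inst-var0 φ ts)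

lemma4p5 : ∀ {n m} {Γ : Vec (Formula n) m} {M N : Proof n m} {φ : Formula n} →
             Γ ⊢ M ∶ φ → M ⟶ N → Γ ⊢ N ∶ φ
lemma4p5 (ty-app (ty-ƛ d) e)              β-ƛ   = ⊢-[]p d e
lemma4p5 (ty-appₜ t (ty-Λ d))             β-Λ   = ⊢-[]t t d
lemma4p5 (ty-fst (ty-pair d e))           β-fst = d
lemma4p5 (ty-snd (ty-pair d e))           β-snd = e
lemma4p5 (ty-case (ty-inl d) e f)         β-inl = ⊢-[]p e d
lemma4p5 (ty-case (ty-inr d) e f)         β-inr = ⊢-[]p f d
lemma4p5 {Γ = Γ} (ty-let {ψ = ψ} (ty-pack t d) e) β-let =
  ⊢-[]p (cast (cong (_ ∷_) (wkΓ-[]F t Γ)) (wkF-[]F t ψ) (⊢-subPt (single t) e)) d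
lemma4p5 (ty-axProp (ty-axRep d))         β-ax  = d
lemma4p5 (ty-ind d)                       β-ind = ⊢-ind-unfold d
lemma4p5 (ty-fst d)      (ξ-fst r)    = ty-fst (lemma4p5 d r)
lemma4p5 (ty-snd d)      (ξ-snd r)    = ty-snd (lemma4p5 d r)
lemma4p5 (ty-case d e f) (ξ-case r)   = ty-case (lemma4p5 d r) e f
lemma4p5 (ty-axProp d)   (ξ-axProp r) = ty-axProp (lemma4p5 d r)
lemma4p5 (ty-let d e)    (ξ-let r)    = ty-let (lemma4p5 d r) e
lemma4p5 (ty-app d e)    (ξ-app r)    = ty-app (lemma4p5 d r) e
lemma4p5 (ty-appₜ t d)   (ξ-appₜ r)   = ty-appₜ t (lemma4p5 d r)
lemma4p5 (ty-magic d)    (ξ-magic r)  = ty-magic (lemma4p5 d r)
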